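{- Let $m,b,s,t\in\mathbb{N}$ with $s\geq 2m+1$, $m\leq b$ and $t\geq\lceil s/m\rceil$, and let $\mathcal{H}(m,b,s,t)=(X,\mathcal{F})$ with associated family $\mathcal{V}$. Then (1) for any $V\in\mathcal{V}$ and $F\in\mathcal{F}$ we have $V\subseteq F$ or $V\cap F=\varnothing$; (2) every $x\in X\setminus\bigcup_{V\in\mathcal{V}}V$ lies in at most one hyperedge of $\mathcal{F}$.
   Context: Directed multigraphs: $\vec{G}_1(b)$ is a single directed edge from $v_0$ to $v_1$; $\vec{G}_{i+1}(b)$ is obtained from $\vec{G}_i(b)$ (startpoint $v_0$, endpoint $v_i$) by adding a new vertex $v_{i+1}$ and $b$ copies of $\vec{G}_i(b)$ from $v_i$ to $v_{i+1}$, pairwise meeting only in $v_i,v_{i+1}$ and meeting the initial $\vec{G}_i(b)$ only in $v_i$. $\vec{H}_t(b)$ ($t\geq3$): vertices $x_0,\dots,x_{b+1}$ and, for each $i\in[b+1]$, $b+1$ copies of $\vec{G}_{t-2}(b)$ from $x_0$ to $x_i$, otherwise on new vertices. The $s$-uniform hypergraph $\mathcal{H}(m,b,s,t)$ with associated family $\mathcal{V}$ of vertex sets: (a) if $s\leq 3m$, take $\vec{H}_t(b)$, replace every vertex $x$ by a set $V_x$ of $m$ vertices (pairwise disjoint), and replace every directed edge $(x,y)$ (counting multiplicities) by the hyperedge consisting of $V_x\cup V_y$ together with $s-2m$ further vertices used in no other hyperedge; $\mathcal{V}=\{V_x\}$. (b) if $s>3m$, take a set $V$ of $m$ vertices and $b+1$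 copies of $\mathcal{H}(m,b,s-m,t-1)$, pairwise disjoint and disjoint from $V$, and add $V$ to every hyperedge of every copy; $\mathcal{V}$ consists of $V$ and all associated sets of the $b+1$ copies. -}

module Defs where

open import Data.Nat using (ℕ; zero; suc; _+_; _*_; _∸_; _≤_; _≤?_; NonZero)
open import Data.Nat.DivMod using (_/_)
open import Data.Fin using (Fin; zero; suc)
open import Data.Unit using (⊤; tt)
open import Data.Empty using (⊥)
open import Data.Sum using (_⊎_; inj₁; inj₂)
open import Data.Product using (_×_; _,_)
open import Relation.Nullary using (yes; no)
open import Relation.Binary.PropositionalEquality using (_≡_)

⌈_/_⌉ : (s m : ℕ) → .{{NonZero m}} → ℕ
⌈ s / m ⌉ = (s + m ∸ 1) / m

-- The directed multigraphs G_{n+1}(b)  (index shifted: level n ↦ G_{n+1})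
-- Vertices: start (v_0), end (v_{n+1}) and internal vertices.

module _ (b : ℕ) where

  Int : ℕ → Set
  Int zero    = ⊥
  -- old internal vertices, the old endpoint v_n, internal vertices of the b copies
  Int (suc n) = Int n ⊎ (⊤ ⊎ (Fin b × Int n))

  data GV (n : ℕ) : Set where
    start : GV n
    end   : GV n
    int   : Int n → GV n

  GE : ℕ → Set
  GE zero    = ⊤
  GE (suc n) = GE n ⊎ (Fin b × GE n)

  old : ∀ {n} → GV n → GV (suc n)
  old start   = start
  old end     = int (inj₂ (inj₁ tt))
  old (int x) = int (inj₁ x)

  -- the k-th new copy of G_{n+1} inside G_{n+2}, from v_{n+1} to v_{n+2}
  copy : ∀ {n} → Fin b → GV n → GV (suc n)
  copy k start   = int (inj₂ (inj₁ tt))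
  copy k end     = end
  copy k (int x) = int (inj₂ (inj₂ (k , x)))

  src tgt : ∀ {n} → GE n → GV n
  src {zero}  tt             = start
  src {suc n} (inj₁ e)       = old (src e)
  src {suc n} (inj₂ (k , e)) = copy k (src e)
  tgt {zero}  tt             = end
  tgt {suc n} (inj₁ e)       = old (tgt e)
  tgt {suc n} (inj₂ (k , e)) = copy k (tgt e)

  -- H_t(b) built from copies of G_{n+1}(b), where n = t - 3.
  -- hub i = x_i (i = 0 .. b+1); for i ∈ [b+1] (encoded as Fin (suc b), i ↦ x_{i+1})
  -- and j ∈ Fin (suc b) the j-th copy of G_{t-2}(b) from x_0 to x_{i+1}.

  data HV (n : ℕ) : Set where
    hub   : Fin (suc (suc b)) → HV n
    inner : Fin (suc b) → Fin (suc b) → Int n → HV n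

  HE : ℕ → Set
  HE n = Fin (suc b) × (Fin (suc b) × GE n)

  place : ∀ {n} → Fin (suc b) → Fin (suc b) → GV n → HV n
  place i j start   = hub zero
  place i j end     = hub (suc i)
  place i j (int x) = inner i j x

  hsrc htgt : ∀ {n} → HE n → HV n
  hsrc (i , j , e) = place i j (src e)
  htgt (i , j , e) = place i j (tgt e)

record Hypergraph : Set₁ where
  field
    X   : Set
    E   : Set
    I   : Set
    _∈E_ : X → E → Set
    _∈V_ : X → I → Set

-- case (a): blow up H_t(b); n = t ∸ 3 so that G_{n+1} = G_{t-2}
baseH : (m b s t : ℕ) → Hypergraph
baseH m b s t = record
  { X = (HV b n × Fin m) ⊎ (HE b n × Fin (s ∸ 2 * m))
  ; E = HE b n
  ; I = HV b n
  ; _∈E_ = inE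
  ; _∈V_ = inV
  }
  where
  n = t ∸ 3
  inE : (HV b n × Fin m) ⊎ (HE b n × Fin (s ∸ 2 * m)) → HE b n → Set
  inE (inj₁ (u , _)) e = (u ≡ hsrc b e) ⊎ (u ≡ htgt b e)
  inE (inj₂ (e' , _)) e = e' ≡ e
  inV : (HV b n × Fin m) ⊎ (HE b n × Fin (s ∸ 2 * m)) → HV b n → Set
  inV (inj₁ (u , _)) w = u ≡ w
  inV (inj₂ _)       w = ⊥

-- case (b): a new m-set V added to every hyperedge of b+1 disjoint copies
glueH : (m b : ℕ) → Hypergraph → Hypergraph
glueH m b H = record
  { X = Fin m ⊎ (Fin (suc b) × X)
  ; E = Fin (suc b) × E
  ; I = ⊤ ⊎ (Fin (suc b) × I)
  ; _∈E_ = inE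
  ; _∈V_ = inV
  }
  where
  open Hypergraph H
  inE : Fin m ⊎ (Fin (suc b) × X) → Fin (suc b) × E → Set
  inE (inj₁ _)       _        = ⊤
  inE (inj₂ (c , x)) (c' , e) = (c ≡ c') × (x ∈E e)
  inV : Fin m ⊎ (Fin (suc b) × X) → ⊤ ⊎ (Fin (suc b) × I) → Set
  inV (inj₁ _)       (inj₁ _)        = ⊤
  inV (inj₁ _)       (inj₂ _)        = ⊥
  inV (inj₂ _)       (inj₁ _)        = ⊥
  inV (inj₂ (c , x)) (inj₂ (c' , v)) = (c ≡ c') × (x ∈V v)

-- 𝓗(m,b,s,t), by recursion on t (case (b) passes to (s - m, t - 1)).
-- Values outside the range s ≥ 2m+1, t ≥ ⌈s/m⌉ are junk and never used.
𝓗 : (m b s t : ℕ) → Hypergraph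
𝓗 m b s zero = baseH m b s zero
𝓗 m b s (suc t) with s ≤? 3 * m
... | yes _ = baseH m b s (suc t)
... | no  _ = glueH m b (𝓗 m b (s ∸ m) t)

VInsideOrDisjoint : Hypergraph → Set
VInsideOrDisjoint H = ∀ (v : I) (e : E) →
  (∀ x → x ∈V v → x ∈E e) ⊎ (∀ x → x ∈V v → x ∈E e → ⊥)
  where open Hypergraph H

OutsideInAtMostOneEdge : Hypergraph → Set
OutsideInAtMostOneEdge H = ∀ (x : X) → (∀ v → x ∈V v → ⊥) →
  ∀ (e e' : E) → x ∈E e → x ∈E e' → e ≡ e'
  where open Hypergraph H

-- In the blow-up of H_t(b) a hyperedge meets a
-- blown-up vertex set V_x either fully (x is an end of the edge) or not at all,
-- and a vertex outside ⋃𝒱 is one of the private vertices of a single edge.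
-- Gluing a new set V into every hyperedge of b+1 disjoint copies preserves both:
-- V lies in every hyperedge, and everything else happens inside one copy.
module Submission where

open import Defs
open import Data.Nat using (ℕ; zero; suc; _*_; _∸_; _≤_; _≤?_; NonZero)
open import Data.Product using (_×_; _,_)
open import Data.Sum using (inj₁; inj₂)
open import Data.Unit using (tt)
open import Data.Empty using (⊥-elim)
import Data.Fin.Properties as Fin
import Data.Sum.Properties as Sum
import Data.Product.Properties as Product
import Data.Unit.Properties as Unit
open import Relation.Nullary using (yes; no)
open import Relation.Nullary.Decidable using (map′; _⊎-dec_)
open import Relation.Binary.Definitions using (DecidableEquality)
open import Relation.Binary.PropositionalEquality using (_≡_; refl; sym; trans; cong)

SatisfiesLemma12 : Hypergraph → Set
SatisfiesLemma12 H = VInsideOrDisjoint H × OutsideInAtMostOneEdge H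

module _ (b : ℕ) where

  Int-≟ : ∀ n → DecidableEquality (Int b n)
  Int-≟ zero    ()
  Int-≟ (suc n) = Sum.≡-dec (Int-≟ n) (Sum.≡-dec Unit._≟_ (Product.≡-dec Fin._≟_ (Int-≟ n)))

  HV-≟ : ∀ n → DecidableEquality (HV b n)
  HV-≟ n (hub i)       (hub j)          = map′ (cong hub) (λ { refl → refl }) (i Fin.≟ j)
  HV-≟ n (hub _)       (inner _ _ _)    = no λ ()
  HV-≟ n (inner _ _ _) (hub _)          = no λ ()
  HV-≟ n (inner i j x) (inner i′ j′ x′) =
    map′ (λ { refl → refl }) (λ { refl → refl })
         (Product.≡-dec Fin._≟_ (Product.≡-dec Fin._≟_ (Int-≟ n)) (i , j , x) (i′ , j′ , x′))

baseH-insideOrDisjoint : ∀ m b s t → VInsideOrDisjoint (baseH m b s t)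
baseH-insideOrDisjoint m b s t v e with HV-≟ b (t ∸ 3) v (hsrc b e) ⊎-dec HV-≟ b (t ∸ 3) v (htgt b e)
... | yes v∈e = inj₁ λ { (inj₁ (_ , _)) refl → v∈e ; (inj₂ _) () }
... | no  v∉e = inj₂ λ { (inj₁ (_ , _)) refl → v∉e ; (inj₂ _) () }

baseH-outsideInAtMostOneEdge : ∀ m b s t → OutsideInAtMostOneEdge (baseH m b s t)
baseH-outsideInAtMostOneEdge m b s t (inj₁ (u , _)) x∉⋃𝒱 _ _ _     _     = ⊥-elim (x∉⋃𝒱 u refl)
baseH-outsideInAtMostOneEdge m b s t (inj₂ (_ , _)) _     _ _ x∈e x∈e′ = trans (sym x∈e) x∈e′

baseH-satisfiesLemma12 : ∀ m b s t → SatisfiesLemma12 (baseH m b s t)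
baseH-satisfiesLemma12 m b s t = baseH-insideOrDisjoint m b s t , baseH-outsideInAtMostOneEdge m b s t

module _ (m b : ℕ) (H : Hypergraph) where
  open Hypergraph H

  glueH-insideOrDisjoint : VInsideOrDisjoint H → VInsideOrDisjoint (glueH m b H)
  glueH-insideOrDisjoint _    (inj₁ tt)     _        = inj₁ λ { (inj₁ _) _ → tt ; (inj₂ _) () }
  glueH-insideOrDisjoint sepH (inj₂ (c , v)) (c′ , e) with c Fin.≟ c′ | sepH v e
  ... | yes refl | inj₁ v⊆e = inj₁ λ { (inj₁ _) () ; (inj₂ (_ , x)) (c≡ , x∈v) → c≡ , v⊆e x x∈v }
  ... | yes refl | inj₂ v∩e = inj₂ λ { (inj₁ _) () ; (inj₂ (_ , x)) (_ , x∈v) (_ , x∈e) → v∩e x x∈v x∈e }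
  ... | no  c≢c′ | _        = inj₂ λ { (inj₁ _) () ; (inj₂ (_ , _)) (c≡ , _) (c′≡ , _) → c≢c′ (trans (sym c≡) c′≡) }

  glueH-outsideInAtMostOneEdge : OutsideInAtMostOneEdge H → OutsideInAtMostOneEdge (glueH m b H)
  glueH-outsideInAtMostOneEdge _     (inj₁ _)       x∉⋃𝒱 _ _ _ _ = ⊥-elim (x∉⋃𝒱 (inj₁ tt) tt)
  glueH-outsideInAtMostOneEdge oneH (inj₂ (c , x)) x∉⋃𝒱 (_ , e) (_ , e′) (refl , x∈e) (refl , x∈e′) =
    cong (c ,_) (oneH x (λ v x∈v → x∉⋃𝒱 (inj₂ (c , v)) (refl , x∈v)) e e′ x∈e x∈e′)

  glueH-satisfiesLemma12 : SatisfiesLemma12 H → SatisfiesLemma12 (glueH m b H)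
  glueH-satisfiesLemma12 (sepH , oneH) = glueH-insideOrDisjoint sepH , glueH-outsideInAtMostOneEdge oneH

𝓗-satisfiesLemma12 : ∀ m b s t → SatisfiesLemma12 (𝓗 m b s t)
𝓗-satisfiesLemma12 m b s zero = baseH-satisfiesLemma12 m b s zero
𝓗-satisfiesLemma12 m b s (suc t) with s ≤? 3 * m
... | yes _ = baseH-satisfiesLemma12 m b s (suc t)
... | no  _ = glueH-satisfiesLemma12 m b (𝓗 m b (s ∸ m) t) (𝓗-satisfiesLemma12 m b (s ∸ m) t)

mainTheorem12 : (m b s t : ℕ) → .{{_ : NonZero m}} →
    suc (2 * m) ≤ s → m ≤ b → ⌈ s / m ⌉ ≤ t →
    VInsideOrDisjoint (𝓗 m b s t) × OutsideInAtMostOneEdge (𝓗 m b s t)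
mainTheorem12 m b s t _ _ _ = 𝓗-satisfiesLemma12 m b s t
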